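{- Let $(X,=_X;F)$ be a function space. Then there exist an extensional subset $\rho F$ of the set of functions $(X,=_{(X,F)})\to\mathbb R$ and a function $\tau_X:(X,=_X)\to(X,=_{(X,F)})$ such that: (i) $\rho_FX:=(X,=_{(X,F)},\neq_{(X,F)};\rho F)$ is a completely separated set; the assignments $\tau_X^*:\rho F\to F$, $\tau^*_X(g):=g\circ\tau_X$, and $\rho_X:F\to\rho F$, $\rho_X(f):=f$, are functions which are inverse to each other (so $F$ and $\rho F$ are equal as sets via $(\tau^*_X,\rho_X)$); and every $f\in\rho F$ is strongly extensional (with respect to $\neq_{(X,F)}$ on $X$ and $\neq_{\mathbb R}$); (ii) for every completely separated set $(Y,=_Y,\neq_Y;G)$ and every affine map $h:(X,=_X;F)\to(Y,=_Y;G)$ there is a unique affine map $\rho h:\rho_FX\to(Y,=_Y,\neq_Y;G)$ with $\rho h\circ\tau_X=h$.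
   Context: Constructive (Bishop-style) setting. A set $(X,=_X)$ has an equality; functions preserve equalities. $\mathbb F(X)$ is the set of real-valued functions on $X$ with pointwise equality; an extensional subset $F\subseteq\mathbb F(X)$ is given by a property $P_F$ with $f=g\wedge P_F(f)\Rightarrow P_F(g)$. $a\neq_{\mathbb R}b$ iff $|a-b|>0$. A function space is a triple $(X,=_X;F)$ with $F$ an extensional subset of $\mathbb F(X)$. For such $F$: $x=_{(X,F)}x'$ iff $\forall f\in F\,f(x)=_{\mathbb R}f(x')$; $x\neq_{(X,F)}x'$ iff $\exists f\in F\,f(x)\neq_{\mathbb R}f(x')$. A map $h:X\to Y$ is affine from $(X,=_X;F)$ to $(Y,=_Y;G)$ (or between completely separated sets with these function sets) if $h$ is a function and $g\circ h\in F$ for all $g\in G$. A set with an inequality is $(X,=_X,\neq_X)$ with $x=_Xy$, $x\neq_Xy$ contradictory; strongly extensional means $f(x)\neq f(y)\Rightarrow x\neq y$. A completely separated set is $(X,=_X,\neq_X;F)$ with $F$ an extensional subset of $\mathbb F(X)$, $\neq_X\Leftrightarrow\neq_{(X,F)}$, and $x=_{(X,F)}x'\Rightarrow x=_Xx'$. -}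

module Defs where

open import Level using (0ℓ)
open import Data.Nat as ℕ using (ℕ; suc)
open import Data.Integer using (+_)
open import Data.Rational using (ℚ; _/_; _-_; ∣_∣; _≤_; _<_; _+_)
open import Data.Product using (Σ; _×_; _,_)
open import Data.Empty using (⊥)
open import Relation.Binary using (Rel; IsEquivalence)

-- Bishop's constructive reals: regular sequences of rationals.
-- Convention: (seq k) is Bishop's x_{k+1}  (Bishop indexes by n ≥ 1).

inv : ℕ → ℚ
inv k = + 1 / suc k

record ℝ : Set where
  field
    seq : ℕ → ℚ
    reg : ∀ m n → ∣ seq m - seq n ∣ ≤ inv m + inv n
open ℝ public

_=ℝ_ : ℝ → ℝ → Set
x =ℝ y = ∀ k → ∣ seq x k - seq y k ∣ ≤ + 2 / suc k

-- a ≠ℝ b  iff  |a - b| > 0.  In Bishop's arithmetic (x - y)_n = x_{2n} - y_{2n},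
-- |z|_n = |z_n|, and z > 0 iff z_n > 1/n for some n ≥ 1.
-- With n = k+1, x_{2n} is (seq x (suc (k + k))).
_≠ℝ_ : ℝ → ℝ → Set
x ≠ℝ y = Σ ℕ λ k → inv k < ∣ seq x (suc (k ℕ.+ k)) - seq y (suc (k ℕ.+ k)) ∣

module _ {X : Set} (_≈_ : Rel X 0ℓ) where

  record 𝔽 : Set where
    field
      fun : X → ℝ
      fun-ext : ∀ {x y} → x ≈ y → fun x =ℝ fun y

  open 𝔽 public

  _≐_ : 𝔽 → 𝔽 → Set
  f ≐ g = ∀ x → fun f x =ℝ fun g x

  record ExtSubset : Set₁ where
    field
      P : 𝔽 → Set
      P-ext : ∀ {f g} → f ≐ g → P f → P g

  open ExtSubset public

  EqF : ExtSubset → X → X → Set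
  EqF F x y = ∀ (f : 𝔽) → P F f → fun f x =ℝ fun f y

  NeqF : ExtSubset → X → X → Set
  NeqF F x y = Σ 𝔽 λ f → P F f × (fun f x ≠ℝ fun f y)

compose : {X Y : Set} {_≈X_ : Rel X 0ℓ} {_≈Y_ : Rel Y 0ℓ}
          (g : 𝔽 _≈Y_) (h : X → Y) → (∀ {x x'} → x ≈X x' → h x ≈Y h x') → 𝔽 _≈X_
compose g h hf = record { fun = λ x → fun g (h x) ; fun-ext = λ e → fun-ext g (hf e) }

IsAffine : {X Y : Set} (_≈X_ : Rel X 0ℓ) (F : ExtSubset _≈X_)
           (_≈Y_ : Rel Y 0ℓ) (G : ExtSubset _≈Y_)
           (h : X → Y) → (∀ {x x'} → x ≈X x' → h x ≈Y h x') → Set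
IsAffine _≈X_ F _≈Y_ G h hf = ∀ (g : 𝔽 _≈Y_) → P G g → P F (compose g h hf)

IsStronglyExtensional : {X : Set} (_≠_ : Rel X 0ℓ) (f : X → ℝ) → Set
IsStronglyExtensional _≠_ f = ∀ x y → f x ≠ℝ f y → x ≠ y

record IsCompletelySeparated {X : Set} (_≈_ : Rel X 0ℓ) (_≠_ : Rel X 0ℓ)
                             (F : ExtSubset _≈_) : Set where
  field
    ≈-isEquivalence : IsEquivalence _≈_
    ≈-≠-contradictory : ∀ {x y} → x ≈ y → x ≠ y → ⊥
    ≠⇒≠F : ∀ {x y} → x ≠ y → NeqF _≈_ F x y
    ≠F⇒≠ : ∀ {x y} → NeqF _≈_ F x y → x ≠ y
    ≈F⇒≈ : ∀ {x y} → EqF _≈_ F x y → x ≈ y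

record CompletelySeparated : Set₁ where
  field
    Carrier : Set
    _≈_ : Rel Carrier 0ℓ
    _≠_ : Rel Carrier 0ℓ
    F : ExtSubset _≈_
    isCompletelySeparated : IsCompletelySeparated _≈_ _≠_ F

liftF : {X : Set} {_≈_ : Rel X 0ℓ} (F : ExtSubset _≈_) (f : 𝔽 _≈_) → P F f → 𝔽 (EqF _≈_ F)
liftF F f pf = record { fun = fun f ; fun-ext = λ e → e f pf }

-- Take τ to be the identity and let ρF consist of the functions g on (X, =_(X,F))
-- whose restriction along τ lies in F; thus ρF is F itself, seen on the coarser
-- equality, and all the bookkeeping of (i) and (ii) is immediate.  The one point
-- with content is that =_(X,F) is an equivalence relation disjoint from ≠_(X,F),
-- i.e. that Bishop equality of reals is transitive and refutes apartness.  For
-- transitivity, |x_k - z_k| ≤ 2/k + 6/m for every m by routing through x_m, y_m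
-- and z_m, and the Archimedean property removes the 6/m.
module Submission where

open import Defs
open import Level using (0ℓ)
open import Data.Nat as ℕ using (ℕ; suc)
import Data.Nat.Properties as ℕ
import Data.Integer.Properties as ℤ
open import Data.Nat.Tactic.RingSolver using (solve-∀)
open import Data.Integer.Tactic.RingSolver using () renaming (solve-∀ to ℤ-solve-∀)
open import Data.Integer as ℤ using (+_; +[1+_]; -[1+_]; +<+)
open import Data.Rational using (mkℚ; *<*; _/_; _-_; ∣_∣; _≤_; _<_; _+_; -_; 0ℚ; toℚᵘ)
import Data.Rational.Properties as ℚ
import Data.Rational.Unnormalised as ℚᵘ
import Data.Rational.Unnormalised.Properties as ℚᵘ
open import Data.Rational.Solver using (module +-*-Solver)
open +-*-Solver using (solve; _:+_; _:-_; :-_; _:=_)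
open import Data.Product using (Σ; _×_; _,_; proj₁; proj₂)
open import Data.Empty using (⊥)
open import Function using (id)
open import Relation.Nullary using (yes; no; contradiction)
open import Relation.Binary using (Rel; IsEquivalence)
open import Relation.Binary.PropositionalEquality
  using (_≡_; refl; sym; trans; cong; cong₂; subst; module ≡-Reasoning)

toℚᵘ-/ : ∀ a k → toℚᵘ (+ a / suc k) ℚᵘ.≃ ℚᵘ.mkℚᵘ (+ a) k
toℚᵘ-/ a k = ℚ.toℚᵘ-fromℚᵘ (ℚᵘ.mkℚᵘ (+ a) k)

/-+-/ : ∀ a b k → + a / suc k + + b / suc k ≡ + (a ℕ.+ b) / suc k
/-+-/ a b k = ℚ.toℚᵘ-injective (ℚᵘ.≃-trans (ℚ.toℚᵘ-homo-+ (+ a / suc k) (+ b / suc k))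
  (ℚᵘ.≃-trans (ℚᵘ.+-cong (toℚᵘ-/ a k) (toℚᵘ-/ b k))
    (ℚᵘ.≃-trans (ℚᵘ.*≡* (cross-multiplied (+ a) (+ b) +[1+ k ])) (ℚᵘ.≃-sym (toℚᵘ-/ (a ℕ.+ b) k)))))
  where
  cross-multiplied : ∀ a b d → (a ℤ.* d ℤ.+ b ℤ.* d) ℤ.* d ≡ (a ℤ.+ b) ℤ.* (d ℤ.* d)
  cross-multiplied = ℤ-solve-∀

0≤/ : ∀ a k → 0ℚ ≤ + a / suc k
0≤/ a k = ℚ.toℚᵘ-cancel-≤ (ℚᵘ.≤-respʳ-≃ (ℚᵘ.≃-sym (toℚᵘ-/ a k))
  (ℚᵘ.*≤* (subst (+ 0 ℤ.≤_) (sym (ℤ.*-identityʳ (+ a))) (ℤ.+≤+ ℕ.z≤n))))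

2/[2+2k]≡inv : ∀ k → + 2 / suc (suc (k ℕ.+ k)) ≡ inv k
2/[2+2k]≡inv k = ℚ.toℚᵘ-injective (ℚᵘ.≃-trans (toℚᵘ-/ 2 (suc (k ℕ.+ k)))
  (ℚᵘ.≃-trans (ℚᵘ.*≡* (cong +_ (cross-multiplied k))) (ℚᵘ.≃-sym (toℚᵘ-/ 1 k))))
  where
  cross-multiplied : ∀ k → 2 ℕ.* suc k ≡ 1 ℕ.* suc (suc (k ℕ.+ k))
  cross-multiplied = solve-∀

/-archimedean : ∀ c q → 0ℚ < q → Σ ℕ λ m → + c / suc m < q
/-archimedean c (mkℚ +[1+ n ] d _) _ = c ℕ.* suc d ,
  ℚ.toℚᵘ-cancel-< (ℚᵘ.<-respˡ-≃ (ℚᵘ.≃-sym (toℚᵘ-/ c (c ℕ.* suc d)))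
    (ℚᵘ.*<* (subst (ℤ._< +[1+ n ] ℤ.* +[1+ c ℕ.* suc d ]) (ℤ.pos-* c (suc d))
      (+<+ (ℕ.<-≤-trans (ℕ.n<1+n (c ℕ.* suc d)) (ℕ.m≤n*m (suc (c ℕ.* suc d)) (suc n)))))))
/-archimedean c (mkℚ (+ 0) _ _) (*<* (+<+ ()))
/-archimedean c (mkℚ -[1+ _ ] _ _) (*<* ())

≤-+-/⇒≤ : ∀ c u v → (∀ m → u ≤ v + + c / suc m) → u ≤ v
≤-+-/⇒≤ c u v u≤v+c/m with u ℚ.≤? v
... | yes u≤v = u≤v
... | no u≰v = contradiction (ℚ.<-≤-trans v+c/m<u (u≤v+c/m m)) (ℚ.<-irrefl refl)
  where
  0<u-v : 0ℚ < u - v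
  0<u-v = subst (_< u - v) (ℚ.+-inverseʳ v) (ℚ.+-mono-<-≤ (ℚ.≰⇒> u≰v) (ℚ.≤-refl { - v}))
  m = proj₁ (/-archimedean c (u - v) 0<u-v)
  v+c/m<u : v + + c / suc m < u
  v+c/m<u = subst (v + + c / suc m <_) (solve 2 (λ u v → v :+ (u :- v) := u) refl u v)
    (ℚ.+-monoʳ-< v (proj₂ (/-archimedean c (u - v) 0<u-v)))

∣p-q∣≡∣q-p∣ : ∀ p q → ∣ p - q ∣ ≡ ∣ q - p ∣
∣p-q∣≡∣q-p∣ p q = trans (sym (ℚ.∣-p∣≡∣p∣ (p - q)))
  (cong ∣_∣ (solve 2 (λ p q → :- (p :- q) := q :- p) refl p q))

∣p-t∣≤four-steps : ∀ p q r s t → ∣ p - t ∣ ≤ ∣ p - q ∣ + ∣ q - r ∣ + ∣ r - s ∣ + ∣ s - t ∣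
∣p-t∣≤four-steps p q r s t = begin
  ∣ p - t ∣                                             ≡⟨ cong ∣_∣ telescope ⟩
  ∣ (p - q) + (q - r) + (r - s) + (s - t) ∣             ≤⟨ ℚ.∣p+q∣≤∣p∣+∣q∣ ((p - q) + (q - r) + (r - s)) (s - t) ⟩
  ∣ (p - q) + (q - r) + (r - s) ∣ + ∣ s - t ∣           ≤⟨ ℚ.+-monoˡ-≤ ∣ s - t ∣ (ℚ.∣p+q∣≤∣p∣+∣q∣ ((p - q) + (q - r)) (r - s)) ⟩
  ∣ (p - q) + (q - r) ∣ + ∣ r - s ∣ + ∣ s - t ∣         ≤⟨ ℚ.+-monoˡ-≤ ∣ s - t ∣ (ℚ.+-monoˡ-≤ ∣ r - s ∣ (ℚ.∣p+q∣≤∣p∣+∣q∣ (p - q) (q - r))) ⟩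
  ∣ p - q ∣ + ∣ q - r ∣ + ∣ r - s ∣ + ∣ s - t ∣         ∎
  where
  open ℚ.≤-Reasoning
  telescope : p - t ≡ (p - q) + (q - r) + (r - s) + (s - t)
  telescope = solve 5 (λ p q r s t → p :- t := (p :- q) :+ (q :- r) :+ (r :- s) :+ (s :- t)) refl p q r s t

=ℝ-refl : ∀ x → x =ℝ x
=ℝ-refl x k = subst (_≤ + 2 / suc k) (cong ∣_∣ (sym (ℚ.+-inverseʳ (seq x k)))) (0≤/ 2 k)

=ℝ-sym : ∀ x y → x =ℝ y → y =ℝ x
=ℝ-sym x y x=y k = subst (_≤ + 2 / suc k) (∣p-q∣≡∣q-p∣ (seq x k) (seq y k)) (x=y k)

=ℝ-trans : ∀ x y z → x =ℝ y → y =ℝ z → x =ℝ z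
=ℝ-trans x y z x=y y=z k = ≤-+-/⇒≤ 6 _ _ λ m → ℚ.≤-trans
  (∣p-t∣≤four-steps (seq x k) (seq x m) (seq y m) (seq z m) (seq z k))
  (ℚ.≤-trans (ℚ.+-mono-≤ (ℚ.+-mono-≤ (ℚ.+-mono-≤ (reg x k m) (x=y m)) (y=z m)) (reg z m k))
    (ℚ.≤-reflexive (error-budget m)))
  where
  open ≡-Reasoning
  i = inv k
  error-budget : ∀ m → let j = inv m in
    (i + j) + + 2 / suc m + + 2 / suc m + (j + i) ≡ + 2 / suc k + + 6 / suc m
  error-budget m = let j = inv m; 2/m = + 2 / suc m in begin
    (i + j) + 2/m + 2/m + (j + i)    ≡⟨ solve 3 (λ i j t → (i :+ j) :+ t :+ t :+ (j :+ i)
                                                        := (i :+ i) :+ ((j :+ j) :+ t :+ t)) refl i j 2/m ⟩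
    (i + i) + ((j + j) + 2/m + 2/m)  ≡⟨ cong₂ _+_ (/-+-/ 1 1 k)
                                          (trans (cong (λ t → t + 2/m + 2/m) (/-+-/ 1 1 m))
                                            (trans (cong (_+ 2/m) (/-+-/ 2 2 m)) (/-+-/ 4 2 m))) ⟩
    + 2 / suc k + + 6 / suc m        ∎

=ℝ⇒¬≠ℝ : ∀ x y → x =ℝ y → x ≠ℝ y → ⊥
=ℝ⇒¬≠ℝ x y x=y (k , inv<∣x-y∣) = ℚ.<-irrefl refl (ℚ.<-≤-trans inv<∣x-y∣ ∣x-y∣≤inv)
  where
  k′ = suc (k ℕ.+ k)
  ∣x-y∣≤inv : ∣ seq x k′ - seq y k′ ∣ ≤ inv k
  ∣x-y∣≤inv = subst (∣ seq x k′ - seq y k′ ∣ ≤_) (2/[2+2k]≡inv k) (x=y k′)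

module Reflection {X : Set} (_≈_ : Rel X 0ℓ) (F : ExtSubset _≈_) where

  _≈F_ : Rel X 0ℓ
  _≈F_ = EqF _≈_ F

  _≉F_ : Rel X 0ℓ
  _≉F_ = NeqF _≈_ F

  ≈⇒≈F : ∀ {x y} → x ≈ y → x ≈F y
  ≈⇒≈F x≈y f _ = fun-ext f x≈y

  restrict : 𝔽 _≈F_ → 𝔽 _≈_
  restrict g = compose g id ≈⇒≈F

  ρF : ExtSubset _≈F_
  ρF = record
    { P = λ g → P F (restrict g)
    ; P-ext = λ g≐g′ → P-ext F g≐g′
    }

  restrict-liftF : ∀ f (f∈F : P F f) → _≐_ _≈_ (restrict (liftF F f f∈F)) f
  restrict-liftF f _ x = =ℝ-refl (fun f x)

  liftF-restrict : ∀ g (g∈ρF : P ρF g) → _≐_ _≈F_ (liftF F (restrict g) g∈ρF) g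
  liftF-restrict g _ x = =ℝ-refl (fun g x)

  liftF∈ρF : ∀ f (f∈F : P F f) → P ρF (liftF F f f∈F)
  liftF∈ρF f f∈F = P-ext F (λ x → =ℝ-refl (fun f x)) f∈F

  ≈F-isEquivalence : IsEquivalence _≈F_
  ≈F-isEquivalence = record
    { refl = λ {x} f _ → =ℝ-refl (fun f x)
    ; sym = λ {x} {y} x≈y f f∈F → =ℝ-sym (fun f x) (fun f y) (x≈y f f∈F)
    ; trans = λ {x} {y} {z} x≈y y≈z f f∈F → =ℝ-trans (fun f x) (fun f y) (fun f z) (x≈y f f∈F) (y≈z f f∈F)
    }

  ρF-isCompletelySeparated : IsCompletelySeparated _≈F_ _≉F_ ρF
  ρF-isCompletelySeparated = record
    { ≈-isEquivalence = ≈F-isEquivalence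
    ; ≈-≠-contradictory = λ { {x} {y} x≈y (f , f∈F , fx≠fy) → =ℝ⇒¬≠ℝ (fun f x) (fun f y) (x≈y f f∈F) fx≠fy }
    ; ≠⇒≠F = λ { (f , f∈F , fx≠fy) → liftF F f f∈F , liftF∈ρF f f∈F , fx≠fy }
    ; ≠F⇒≠ = λ { (g , g∈ρF , gx≠gy) → restrict g , g∈ρF , gx≠gy }
    ; ≈F⇒≈ = λ x≈y f f∈F → x≈y (liftF F f f∈F) (liftF∈ρF f f∈F)
    }

  ρF-stronglyExtensional : ∀ g → P ρF g → IsStronglyExtensional _≉F_ (fun g)
  ρF-stronglyExtensional g g∈ρF _ _ gx≠gy = restrict g , g∈ρF , gx≠gy

  module _ (Y : CompletelySeparated) where
    open CompletelySeparated Y renaming (Carrier to Y₀; _≈_ to _≈Y_; F to G)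
    open IsCompletelySeparated isCompletelySeparated using (≈-isEquivalence; ≈F⇒≈)

    ≈Y-refl : ∀ {y} → y ≈Y y
    ≈Y-refl = IsEquivalence.refl ≈-isEquivalence

    affine-respects-≈F : (h : X → Y₀) (h-fun : ∀ {x x′} → x ≈ x′ → h x ≈Y h x′) →
      IsAffine _≈_ F _≈Y_ G h h-fun → ∀ {x x′} → x ≈F x′ → h x ≈Y h x′
    affine-respects-≈F h h-fun h-affine x≈x′ = ≈F⇒≈ λ g g∈G → x≈x′ (compose g h h-fun) (h-affine g g∈G)

    affine-ρF : (h : X → Y₀) (h-fun : ∀ {x x′} → x ≈ x′ → h x ≈Y h x′)
      (h-affine : IsAffine _≈_ F _≈Y_ G h h-fun) →
      IsAffine _≈F_ ρF _≈Y_ G h (affine-respects-≈F h h-fun h-affine)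
    affine-ρF h h-fun h-affine g g∈G = P-ext F (λ x → =ℝ-refl (fun g (h x))) (h-affine g g∈G)

theorem6p2 : (X : Set) (_≈_ : Rel X 0ℓ) → IsEquivalence _≈_ → (F : ExtSubset _≈_) →
    Σ (ExtSubset (EqF _≈_ F)) λ ρF →
    Σ (X → X) λ τ →
    Σ (∀ {x y} → x ≈ y → EqF _≈_ F (τ x) (τ y)) λ τ-fun →
    Σ (∀ g → P ρF g → P F (compose g τ τ-fun)) λ τ* →
    Σ (∀ f (pf : P F f) → P ρF (liftF F f pf)) λ ρX →
      ( IsCompletelySeparated (EqF _≈_ F) (NeqF _≈_ F) ρF
      × (∀ g g' → P ρF g → P ρF g' → _≐_ (EqF _≈_ F) g g' →
           _≐_ _≈_ (compose g τ τ-fun) (compose g' τ τ-fun))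
      × (∀ f f' (pf : P F f) (pf' : P F f') → _≐_ _≈_ f f' →
           _≐_ (EqF _≈_ F) (liftF F f pf) (liftF F f' pf'))
      × (∀ g (pg : P ρF g) → _≐_ (EqF _≈_ F) (liftF F (compose g τ τ-fun) (τ* g pg)) g)
      × (∀ f (pf : P F f) → _≐_ _≈_ (compose (liftF F f pf) τ τ-fun) f)
      × (∀ g → P ρF g → IsStronglyExtensional (NeqF _≈_ F) (fun g))
      × (∀ (Y : CompletelySeparated) (h : X → CompletelySeparated.Carrier Y)
           (hf : ∀ {x x'} → x ≈ x' → CompletelySeparated._≈_ Y (h x) (h x')) →
           IsAffine _≈_ F (CompletelySeparated._≈_ Y) (CompletelySeparated.F Y) h hf →
           Σ (X → CompletelySeparated.Carrier Y) λ k →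
           Σ (∀ {x x'} → EqF _≈_ F x x' → CompletelySeparated._≈_ Y (k x) (k x')) λ kf →
             ( IsAffine (EqF _≈_ F) ρF (CompletelySeparated._≈_ Y) (CompletelySeparated.F Y) k kf
             × (∀ x → CompletelySeparated._≈_ Y (k (τ x)) (h x))
             × (∀ (k' : X → CompletelySeparated.Carrier Y)
                  (kf' : ∀ {x x'} → EqF _≈_ F x x' → CompletelySeparated._≈_ Y (k' x) (k' x')) →
                  IsAffine (EqF _≈_ F) ρF (CompletelySeparated._≈_ Y) (CompletelySeparated.F Y) k' kf' →
                  (∀ x → CompletelySeparated._≈_ Y (k' (τ x)) (h x)) →
                  ∀ x → CompletelySeparated._≈_ Y (k' x) (k x)))))
theorem6p2 X _≈_ _ F =
  ρF , id , ≈⇒≈F , (λ _ g∈ρF → g∈ρF) , liftF∈ρF ,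
  ρF-isCompletelySeparated ,
  (λ _ _ _ _ g≐g′ → g≐g′) ,
  (λ _ _ _ _ f≐f′ → f≐f′) ,
  liftF-restrict ,
  restrict-liftF ,
  ρF-stronglyExtensional ,
  λ Y h h-fun h-affine →
    h , affine-respects-≈F Y h h-fun h-affine , affine-ρF Y h h-fun h-affine ,
    (λ _ → ≈Y-refl Y) ,
    λ _ _ _ k′∘τ≈h → k′∘τ≈h
  where open Reflection _≈_ F
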